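{- For $|q|<1$, \[ \sum_{n=0}^{\infty}\left( 1 -(-q^{n+1};q)_\infty \right)(q^{n+1};q)_\infty=\sum_{n=1}^{\infty}\frac{n (-1)^n q^{n^2}}{(q;q)_n}(-q^{n+1};q)_\infty=-\sum_{n=1}^{\infty} \frac{q^{n(n+1)/2}}{1-q^n}. \]
   Context: For $x\in\mathbb{C}$, $(x;q)_n=\prod_{j=0}^{n-1}(1-xq^j)$ (with $(x;q)_0=1$) and $(x;q)_\infty=\prod_{j=0}^{\infty}(1-xq^j)$. -}

module Defs where

open import Data.Nat as ℕ using (ℕ; zero; suc; _∸_)
open import Data.Nat.DivMod using (_/_)
open import Data.Integer using (ℤ; +_; -_; _+_; _*_; 0ℤ; 1ℤ; -1ℤ)
open import Relation.Nullary using (yes; no)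

-- Formal power series in q with integer coefficients: N ↦ [q^N] f.
FPS : Set
FPS = ℕ → ℤ

Σ< : ℕ → (ℕ → ℤ) → ℤ
Σ< zero    f = 0ℤ
Σ< (suc n) f = Σ< n f + f n

infixl 6 _⊕_ _⊖_
infix 8 ⊖_
infixl 7 _⊗_

_⊕_ : FPS → FPS → FPS
(f ⊕ g) N = f N + g N

⊖_ : FPS → FPS
(⊖ f) N = - f N

_⊖_ : FPS → FPS → FPS
f ⊖ g = f ⊕ (⊖ g)

_⊗_ : FPS → FPS → FPS
(f ⊗ g) N = Σ< (suc N) (λ k → f k * g (N ∸ k))

𝟙 : FPS
𝟙 zero    = 1ℤ
𝟙 (suc _) = 0ℤ

mono : ℤ → ℕ → FPS
mono c m N with m ℕ.≟ N
... | yes _ = c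
... | no  _ = 0ℤ

-- reciprocal of a power series with constant term 1
-- (inv f)_0 = 1, (inv f)_{N+1} = - Σ_{i=0}^{N} f_{i+1} (inv f)_{N-i};
-- computed with fuel, which is always sufficient (fuel N+1 for index N).
invAux : ℕ → FPS → FPS
invAux zero    f _       = 0ℤ
invAux (suc k) f zero    = 1ℤ
invAux (suc k) f (suc N) = - Σ< (suc N) (λ i → f (suc i) * invAux k f (N ∸ i))

inv : FPS → FPS
inv f N = invAux (suc N) f N

∏< : ℕ → (ℕ → FPS) → FPS
∏< zero    f = 𝟙
∏< (suc n) f = ∏< n f ⊗ f n

-- formal infinite product Π_{j≥0} f j, valid when f j = 1 + O(q^{j+1})
-- (then the coefficient of q^N only depends on the factors j ≤ N)
∏∞ : (ℕ → FPS) → FPS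
∏∞ f N = ∏< (suc N) f N

-- formal infinite sum Σ_{n≥0} a n, valid when a n = O(q^n)
Σ∞ : (ℕ → FPS) → FPS
Σ∞ a N = Σ< (suc N) (λ n → a n N)

-- formal infinite sum Σ_{n≥1} a n, valid when a n = O(q^n)
Σ∞₁ : (ℕ → FPS) → FPS
Σ∞₁ a N = Σ< N (λ n → a (suc n) N)

q^ : ℕ → FPS
q^ m = mono 1ℤ m

poch : FPS → ℕ → FPS
poch x n = ∏< n (λ j → 𝟙 ⊖ x ⊗ q^ j)

-- (x;q)_∞ = Π_{j≥0} (1 - x q^j)   (used only for x = ±q^m, m ≥ 1)
poch∞ : FPS → FPS
poch∞ x = ∏∞ (λ j → 𝟙 ⊖ x ⊗ q^ j)

sgnPow : ℕ → ℤ
sgnPow zero    = 1ℤ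
sgnPow (suc n) = - sgnPow n

lhs : FPS
lhs = Σ∞ (λ n → (𝟙 ⊖ poch∞ (mono -1ℤ (suc n))) ⊗ poch∞ (q^ (suc n)))

mid : FPS
mid = Σ∞₁ (λ n → mono ((+ n) * sgnPow n) (n ℕ.* n) ⊗ inv (poch (q^ 1) n)
                   ⊗ poch∞ (mono -1ℤ (suc n)))

rhs : FPS
rhs = ⊖ Σ∞₁ (λ n → q^ ((n ℕ.* suc n) / 2) ⊗ inv (𝟙 ⊖ q^ n))

{-# OPTIONS --safe #-}

-- Write A k = (-q^{k+1};q)_∞ and B k = (q^{k+1};q)_∞. Each of the three series is the value
-- at m = 0 of a family
--   L m = Σ_{n≥0} (1 - A (n+m)) B n,
--   M m = Σ_{n≥0} n (-1)^n q^{n²+mn} A (n+m) / (q;q)_n,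
--   R m = - Σ_{n≥1} q^{n(n+1)/2 + mn} / (1 - q^n),
-- and each of these families satisfies F m = O(q^{m+1}) and F m - F (m+1) = - W m, where
-- W m = Σ_{n≥1} q^{n(n+1)/2 + mn}. These two properties determine F 0: the difference of two
-- such families does not depend on m and is O(q^{m+1}) for every m.
-- For R the difference is computed termwise, the factor 1 - q^n cancelling. For L and M one
-- shows that D m = F (m+1) - F m satisfies D m = q^{m+1} (1 + D (m+1)), as W does; this
-- recursion has only one solution, since iterating it makes the difference of two solutions
-- divisible by every power of q. For L this follows from A k = (1 + q^{k+1}) A (k+1) and the
-- telescoping identity Σ_n q^n A (n+m) B n = 1 + q^{m+1} Σ_n q^n A (n+m+1) B n; for M the
-- termwise computation also needs Σ_n (-1)^n q^{n²+mn} A (n+m) / (q;q)_n = 1, which is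
-- proved by the same uniqueness argument.

module Submission where

open import Defs
open import Algebra.Bundles using (CommutativeRing)
import Algebra.Solver.Ring
open import Algebra.Solver.Ring.AlmostCommutativeRing using (fromCommutativeRing; _-Raw-AlmostCommutative⟶_)
open import Data.Empty using (⊥-elim)
open import Data.Integer using (ℤ; +_; -_; _+_; _*_; 0ℤ; 1ℤ; -1ℤ)
import Data.Integer.Properties as ℤP
open import Data.Integer.Tactic.RingSolver using (solve-∀)
open import Data.Maybe using (Maybe; just; nothing)
open import Data.Nat as ℕ using (ℕ; zero; suc; _∸_; _≤_; _<_; _≤′_; z≤n; s≤s; ≤′-refl; ≤′-step)
open import Data.Nat.DivMod using (_/_; m*n/n≡m)
import Data.Nat.Properties as ℕP
import Data.Nat.Tactic.RingSolver as ℕ-Solver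
open import Data.Product using (_×_; _,_)
open import Function using (_∘_)
open import Level using (0ℓ)
open import Relation.Binary.PropositionalEquality
import Relation.Binary.Reasoning.Setoid
open import Relation.Nullary using (yes; no)

open import Algebra.Properties.CommutativeSemigroup ℤP.+-commutativeSemigroup using (interchange)

-- Finite sums

Σ<-cong : ∀ n {f g : ℕ → ℤ} → (∀ k → k < n → f k ≡ g k) → Σ< n f ≡ Σ< n g
Σ<-cong zero    f≡g = refl
Σ<-cong (suc n) f≡g = cong₂ _+_ (Σ<-cong n (λ k k<n → f≡g k (ℕP.m<n⇒m<1+n k<n))) (f≡g n ℕP.≤-refl)

Σ<-0 : ∀ n {f : ℕ → ℤ} → (∀ k → k < n → f k ≡ 0ℤ) → Σ< n f ≡ 0ℤ
Σ<-0 zero    f≡0 = refl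
Σ<-0 (suc n) f≡0 = cong₂ _+_ (Σ<-0 n (λ k k<n → f≡0 k (ℕP.m<n⇒m<1+n k<n))) (f≡0 n ℕP.≤-refl)

Σ<-+ : ∀ n (f g : ℕ → ℤ) → Σ< n (λ k → f k + g k) ≡ Σ< n f + Σ< n g
Σ<-+ zero    f g = refl
Σ<-+ (suc n) f g = trans (cong (_+ (f n + g n)) (Σ<-+ n f g)) (interchange (Σ< n f) (Σ< n g) (f n) (g n))

Σ<-neg : ∀ n (f : ℕ → ℤ) → Σ< n (λ k → - f k) ≡ - Σ< n f
Σ<-neg zero    f = refl
Σ<-neg (suc n) f = trans (cong (_+ - f n) (Σ<-neg n f)) (sym (ℤP.neg-distrib-+ (Σ< n f) (f n)))

Σ<-*ˡ : ∀ n c (f : ℕ → ℤ) → Σ< n (λ k → c * f k) ≡ c * Σ< n f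
Σ<-*ˡ zero    c f = sym (ℤP.*-zeroʳ c)
Σ<-*ˡ (suc n) c f = trans (cong (_+ c * f n) (Σ<-*ˡ n c f)) (sym (ℤP.*-distribˡ-+ c (Σ< n f) (f n)))

Σ<-head : ∀ n (f : ℕ → ℤ) → Σ< (suc n) f ≡ f 0 + Σ< n (f ∘ suc)
Σ<-head zero    f = ℤP.+-comm 0ℤ (f 0)
Σ<-head (suc n) f = trans (cong (_+ f (suc n)) (Σ<-head n f)) (ℤP.+-assoc (f 0) (Σ< n (f ∘ suc)) (f (suc n)))

Σ<-swap : ∀ n m (F : ℕ → ℕ → ℤ) → Σ< n (λ i → Σ< m (F i)) ≡ Σ< m (λ j → Σ< n (λ i → F i j))
Σ<-swap zero    m F = sym (Σ<-0 m (λ _ _ → refl))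
Σ<-swap (suc n) m F = trans (cong (_+ Σ< m (F n)) (Σ<-swap n m F)) (sym (Σ<-+ m (λ j → Σ< n (λ i → F i j)) (F n)))

Σ<-extend : ∀ {n M} (f : ℕ → ℤ) → n ≤ M → (∀ k → n ≤ k → f k ≡ 0ℤ) → Σ< M f ≡ Σ< n f
Σ<-extend {n} f n≤M f≡0 = go (ℕP.≤⇒≤′ n≤M)
  where
  go : ∀ {M} → n ≤′ M → Σ< M f ≡ Σ< n f
  go ≤′-refl        = refl
  go (≤′-step n≤′M) = trans (cong₂ _+_ (go n≤′M) (f≡0 _ (ℕP.≤′⇒≤ n≤′M))) (ℤP.+-identityʳ _)

Σ<-single : ∀ n {m} (f : ℕ → ℤ) → m < n → (∀ k → k ≢ m → f k ≡ 0ℤ) → Σ< n f ≡ f m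
Σ<-single (suc n) {m} f m<1+n f≡0 with m ℕ.≟ n
... | yes refl = trans (cong (_+ f m) (Σ<-0 n (λ k k<n → f≡0 k (ℕP.<⇒≢ k<n)))) (ℤP.+-identityˡ _)
... | no m≢n   = trans (cong₂ _+_ (Σ<-single n f (ℕP.≤∧≢⇒< (ℕP.≤-pred m<1+n) m≢n) f≡0) (f≡0 n (m≢n ∘ sym)))
                       (ℤP.+-identityʳ _)

-- Formal power series

≗-refl : {f : FPS} → f ≗ f
≗-refl N = refl

≗-sym : {f g : FPS} → f ≗ g → g ≗ f
≗-sym f≗g N = sym (f≗g N)

≗-trans : {f g h : FPS} → f ≗ g → g ≗ h → f ≗ h
≗-trans f≗g g≗h N = trans (f≗g N) (g≗h N)

𝟘 : FPS
𝟘 _ = 0ℤ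

constant : ℤ → FPS
constant c zero    = c
constant c (suc _) = 0ℤ

shift : FPS → FPS
shift f N = f (suc N)

infixl 7 _•_
_•_ : ℤ → FPS → FPS
(c • f) N = c * f N

⊕-cong : ∀ {f f′ g g′} → f ≗ f′ → g ≗ g′ → f ⊕ g ≗ f′ ⊕ g′
⊕-cong f≗f′ g≗g′ N = cong₂ _+_ (f≗f′ N) (g≗g′ N)

⊖-cong : ∀ {f f′} → f ≗ f′ → ⊖ f ≗ ⊖ f′
⊖-cong f≗f′ N = cong -_ (f≗f′ N)

⊗-at-0 : ∀ f g → (f ⊗ g) 0 ≡ f 0 * g 0
⊗-at-0 f g = ℤP.+-identityˡ _

⊗-at-suc : ∀ f g N → (f ⊗ g) (suc N) ≡ f 0 * g (suc N) + (shift f ⊗ g) N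
⊗-at-suc f g N = Σ<-head (suc N) (λ k → f k * g (suc N ∸ k))

⊗-at-sucʳ : ∀ f g N → (f ⊗ g) (suc N) ≡ (f ⊗ shift g) N + f (suc N) * g 0
⊗-at-sucʳ f g N =
  cong₂ _+_ (Σ<-cong (suc N) (λ k k<1+N → cong (λ i → f k * g i) (ℕP.+-∸-assoc 1 (ℕP.≤-pred k<1+N))))
            (cong (λ i → f (suc N) * g i) (ℕP.n∸n≡0 N))

⊗-congˡ : ∀ {f f′} g → f ≗ f′ → f ⊗ g ≗ f′ ⊗ g
⊗-congˡ g f≗f′ N = Σ<-cong (suc N) (λ k _ → cong (_* g (N ∸ k)) (f≗f′ k))

⊗-congʳ : ∀ f {g g′} → g ≗ g′ → f ⊗ g ≗ f ⊗ g′
⊗-congʳ f g≗g′ N = Σ<-cong (suc N) (λ k _ → cong (f k *_) (g≗g′ (N ∸ k)))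

⊗-cong : ∀ {f f′ g g′} → f ≗ f′ → g ≗ g′ → f ⊗ g ≗ f′ ⊗ g′
⊗-cong {f′ = f′} {g} f≗f′ g≗g′ = ≗-trans (⊗-congˡ g f≗f′) (⊗-congʳ f′ g≗g′)

⊗-distribʳ-⊕ : ∀ h f g → (f ⊕ g) ⊗ h ≗ f ⊗ h ⊕ g ⊗ h
⊗-distribʳ-⊕ h f g N =
  trans (Σ<-cong (suc N) (λ k _ → ℤP.*-distribʳ-+ (h (N ∸ k)) (f k) (g k))) (Σ<-+ (suc N) _ _)

⊗-distribˡ-⊕ : ∀ f g h → f ⊗ (g ⊕ h) ≗ f ⊗ g ⊕ f ⊗ h
⊗-distribˡ-⊕ f g h N =
  trans (Σ<-cong (suc N) (λ k _ → ℤP.*-distribˡ-+ (f k) (g (N ∸ k)) (h (N ∸ k)))) (Σ<-+ (suc N) _ _)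

•-⊗ : ∀ c f g → c • f ⊗ g ≗ c • (f ⊗ g)
•-⊗ c f g N = trans (Σ<-cong (suc N) (λ k _ → ℤP.*-assoc c (f k) (g (N ∸ k)))) (Σ<-*ˡ (suc N) c _)

⊗-zeroˡ : ∀ g → 𝟘 ⊗ g ≗ 𝟘
⊗-zeroˡ g N = Σ<-0 (suc N) (λ k _ → refl)

⊗-comm : ∀ f g → f ⊗ g ≗ g ⊗ f
⊗-comm f g zero    = trans (⊗-at-0 f g) (trans (ℤP.*-comm (f 0) (g 0)) (sym (⊗-at-0 g f)))
⊗-comm f g (suc N) = begin
  (f ⊗ g) (suc N)                       ≡⟨ ⊗-at-suc f g N ⟩
  f 0 * g (suc N) + (shift f ⊗ g) N     ≡⟨ cong₂ _+_ (ℤP.*-comm (f 0) (g (suc N))) (⊗-comm (shift f) g N) ⟩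
  g (suc N) * f 0 + (g ⊗ shift f) N     ≡⟨ ℤP.+-comm (g (suc N) * f 0) ((g ⊗ shift f) N) ⟩
  (g ⊗ shift f) N + g (suc N) * f 0     ≡⟨ ⊗-at-sucʳ g f N ⟨
  (g ⊗ f) (suc N)                       ∎
  where open ≡-Reasoning

⊗-identityˡ : ∀ f → 𝟙 ⊗ f ≗ f
⊗-identityˡ f zero    = trans (⊗-at-0 𝟙 f) (ℤP.*-identityˡ (f 0))
⊗-identityˡ f (suc N) = trans (⊗-at-suc 𝟙 f N)
  (trans (cong₂ _+_ (ℤP.*-identityˡ (f (suc N))) (⊗-zeroˡ f N)) (ℤP.+-identityʳ _))

⊗-identityʳ : ∀ f → f ⊗ 𝟙 ≗ f
⊗-identityʳ f = ≗-trans (⊗-comm f 𝟙) (⊗-identityˡ f)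

shift-⊗ : ∀ f g → shift (f ⊗ g) ≗ f 0 • shift g ⊕ shift f ⊗ g
shift-⊗ f g = ⊗-at-suc f g

⊗-assoc : ∀ f g h → (f ⊗ g) ⊗ h ≗ f ⊗ (g ⊗ h)
⊗-assoc f g h zero = begin
  ((f ⊗ g) ⊗ h) 0    ≡⟨ trans (⊗-at-0 (f ⊗ g) h) (cong (_* h 0) (⊗-at-0 f g)) ⟩
  f 0 * g 0 * h 0    ≡⟨ ℤP.*-assoc (f 0) (g 0) (h 0) ⟩
  f 0 * (g 0 * h 0)  ≡⟨ trans (⊗-at-0 f (g ⊗ h)) (cong (f 0 *_) (⊗-at-0 g h)) ⟨
  (f ⊗ (g ⊗ h)) 0    ∎
  where open ≡-Reasoning
⊗-assoc f g h (suc N) = begin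
  ((f ⊗ g) ⊗ h) (suc N)
    ≡⟨ ⊗-at-suc (f ⊗ g) h N ⟩
  (f ⊗ g) 0 * h (suc N) + (shift (f ⊗ g) ⊗ h) N
    ≡⟨ cong₂ _+_ (cong (_* h (suc N)) (⊗-at-0 f g)) (⊗-congˡ h (shift-⊗ f g) N) ⟩
  f 0 * g 0 * h (suc N) + ((f 0 • shift g ⊕ shift f ⊗ g) ⊗ h) N
    ≡⟨ cong (_+_ (f 0 * g 0 * h (suc N))) (⊗-distribʳ-⊕ h (f 0 • shift g) (shift f ⊗ g) N) ⟩
  f 0 * g 0 * h (suc N) + ((f 0 • shift g ⊗ h) N + ((shift f ⊗ g) ⊗ h) N)
    ≡⟨ cong (_+_ (f 0 * g 0 * h (suc N))) (cong₂ _+_ (•-⊗ (f 0) (shift g) h N) (⊗-assoc (shift f) g h N)) ⟩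
  f 0 * g 0 * h (suc N) + (f 0 * (shift g ⊗ h) N + (shift f ⊗ (g ⊗ h)) N)
    ≡⟨ factor (f 0) (g 0) (h (suc N)) ((shift g ⊗ h) N) ((shift f ⊗ (g ⊗ h)) N) ⟩
  f 0 * (g 0 * h (suc N) + (shift g ⊗ h) N) + (shift f ⊗ (g ⊗ h)) N
    ≡⟨ cong (λ x → f 0 * x + (shift f ⊗ (g ⊗ h)) N) (⊗-at-suc g h N) ⟨
  f 0 * (g ⊗ h) (suc N) + (shift f ⊗ (g ⊗ h)) N
    ≡⟨ ⊗-at-suc f (g ⊗ h) N ⟨
  (f ⊗ (g ⊗ h)) (suc N) ∎
  where
  open ≡-Reasoning
  factor : ∀ a b c d e → a * b * c + (a * d + e) ≡ a * (b * c + d) + e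
  factor = solve-∀

⊕-⊗-commutativeRing : CommutativeRing 0ℓ 0ℓ
⊕-⊗-commutativeRing = record
  { Carrier = FPS ; _≈_ = _≗_ ; _+_ = _⊕_ ; _*_ = _⊗_ ; -_ = ⊖_ ; 0# = 𝟘 ; 1# = 𝟙
  ; isCommutativeRing = record
    { isRing = record
      { +-isAbelianGroup = record
        { isGroup = record
          { isMonoid = record
            { isSemigroup = record
              { isMagma = record
                { isEquivalence = record { refl = ≗-refl ; sym = ≗-sym ; trans = ≗-trans }
                ; ∙-cong = ⊕-cong }
              ; assoc = λ f g h N → ℤP.+-assoc (f N) (g N) (h N) }
            ; identity = (λ f N → ℤP.+-identityˡ (f N)) , (λ f N → ℤP.+-identityʳ (f N)) }
          ; inverse = (λ f N → ℤP.+-inverseˡ (f N)) , (λ f N → ℤP.+-inverseʳ (f N))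
          ; ⁻¹-cong = ⊖-cong }
        ; comm = λ f g N → ℤP.+-comm (f N) (g N) }
      ; *-cong = ⊗-cong
      ; *-assoc = ⊗-assoc
      ; *-identity = ⊗-identityˡ , ⊗-identityʳ
      ; distrib = ⊗-distribˡ-⊕ , ⊗-distribʳ-⊕ }
    ; *-comm = ⊗-comm } }

module ≗-Reasoning = Relation.Binary.Reasoning.Setoid (CommutativeRing.setoid ⊕-⊗-commutativeRing)

constant-+ : ∀ a b → constant (a + b) ≗ constant a ⊕ constant b
constant-+ a b zero    = refl
constant-+ a b (suc N) = refl

constant-* : ∀ a b → constant (a * b) ≗ constant a ⊗ constant b
constant-* a b zero    = sym (⊗-at-0 (constant a) (constant b))
constant-* a b (suc N) =
  sym (trans (⊗-at-suc (constant a) (constant b) N) (cong₂ _+_ (ℤP.*-zeroʳ a) (⊗-zeroˡ (constant b) N)))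

constant-neg : ∀ a → constant (- a) ≗ ⊖ constant a
constant-neg a zero    = refl
constant-neg a (suc N) = refl

constant-0 : constant 0ℤ ≗ 𝟘
constant-0 zero    = refl
constant-0 (suc N) = refl

constant-1 : constant 1ℤ ≗ 𝟙
constant-1 zero    = refl
constant-1 (suc N) = refl

constant-homomorphism : CommutativeRing.rawRing ℤP.+-*-commutativeRing
                          -Raw-AlmostCommutative⟶ fromCommutativeRing ⊕-⊗-commutativeRing
constant-homomorphism = record
  { ⟦_⟧ = constant ; +-homo = constant-+ ; *-homo = constant-* ; -‿homo = constant-neg
  ; 0-homo = constant-0 ; 1-homo = constant-1 }

constant-≟ : ∀ a b → Maybe (constant a ≗ constant b)
constant-≟ a b with a ℤP.≟ b
... | yes refl = just ≗-refl
... | no _     = nothing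

module FPS-Solver = Algebra.Solver.Ring (CommutativeRing.rawRing ℤP.+-*-commutativeRing)
  (fromCommutativeRing ⊕-⊗-commutativeRing) constant-homomorphism constant-≟
open FPS-Solver using (solve; _:+_; _:*_; :-_; _:-_; con; _:=_)

-- The solver reads the literal one as `constant 1ℤ`, which is only pointwise equal to 𝟙.
𝟏 : FPS
𝟏 = constant 1ℤ

𝟙≗𝟏 : 𝟙 ≗ 𝟏
𝟙≗𝟏 = ≗-sym constant-1

infix 4 _≗[<_]_ _=O[q^_]

_≗[<_]_ : FPS → ℕ → FPS → Set
f ≗[< k ] g = ∀ N → N < k → f N ≡ g N

_=O[q^_] : FPS → ℕ → Set
f =O[q^ k ] = f ≗[< k ] 𝟘

≗⇒≗[<] : ∀ {f g} k → f ≗ g → f ≗[< k ] g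
≗⇒≗[<] k f≗g N _ = f≗g N

≗[<]-refl : ∀ {k} f → f ≗[< k ] f
≗[<]-refl f N _ = refl

≗[<]-sym : ∀ {k f g} → f ≗[< k ] g → g ≗[< k ] f
≗[<]-sym f≗g N N<k = sym (f≗g N N<k)

≗[<]-trans : ∀ {k f g h} → f ≗[< k ] g → g ≗[< k ] h → f ≗[< k ] h
≗[<]-trans f≗g g≗h N N<k = trans (f≗g N N<k) (g≗h N N<k)

≗[<]-weaken : ∀ {j k f g} → j ≤ k → f ≗[< k ] g → f ≗[< j ] g
≗[<]-weaken j≤k f≗g N N<j = f≗g N (ℕP.<-≤-trans N<j j≤k)

⊕-cong-≗[<] : ∀ {k f f′ g g′} → f ≗[< k ] f′ → g ≗[< k ] g′ → f ⊕ g ≗[< k ] f′ ⊕ g′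
⊕-cong-≗[<] f≗f′ g≗g′ N N<k = cong₂ _+_ (f≗f′ N N<k) (g≗g′ N N<k)

⊖-cong-≗[<] : ∀ {k f f′} → f ≗[< k ] f′ → ⊖ f ≗[< k ] ⊖ f′
⊖-cong-≗[<] f≗f′ N N<k = cong -_ (f≗f′ N N<k)

⊗-cong-≗[<] : ∀ {k f f′ g g′} → f ≗[< k ] f′ → g ≗[< k ] g′ → f ⊗ g ≗[< k ] f′ ⊗ g′
⊗-cong-≗[<] f≗f′ g≗g′ N N<k = Σ<-cong (suc N) (λ i i<1+N → cong₂ _*_
  (f≗f′ i (ℕP.≤-<-trans (ℕP.≤-pred i<1+N) N<k)) (g≗g′ (N ∸ i) (ℕP.≤-<-trans (ℕP.m∸n≤m N i) N<k)))

≗[<]⇒⊖=O : ∀ {k f g} → f ≗[< k ] g → g ⊖ f =O[q^ k ]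
≗[<]⇒⊖=O {g = g} f≗g N N<k = trans (cong (λ x → g N + - x) (f≗g N N<k)) (ℤP.+-inverseʳ (g N))

O-⊗ : ∀ {a b f g} → f =O[q^ a ] → g =O[q^ b ] → f ⊗ g =O[q^ a ℕ.+ b ]
O-⊗ {a} {b} {f} {g} f=O g=O N N<a+b = Σ<-0 (suc N) term
  where
  term : ∀ k → k < suc N → f k * g (N ∸ k) ≡ 0ℤ
  term k k<1+N with k ℕ.<? a
  ... | yes k<a = cong (_* g (N ∸ k)) (f=O k k<a)
  ... | no  k≮a = trans (cong (f k *_) (g=O (N ∸ k) N∸k<b)) (ℤP.*-zeroʳ (f k))
    where
    N∸k<b : N ∸ k < b
    N∸k<b = ℕP.+-cancelˡ-< a (N ∸ k) b (ℕP.≤-<-trans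
      (ℕP.≤-trans (ℕP.+-monoˡ-≤ (N ∸ k) (ℕP.≮⇒≥ k≮a)) (ℕP.≤-reflexive (ℕP.m+[n∸m]≡n (ℕP.≤-pred k<1+N)))) N<a+b)

O-⊗ʳ : ∀ {b} f {g} → g =O[q^ b ] → f ⊗ g =O[q^ b ]
O-⊗ʳ f g=O = O-⊗ {0} {f = f} (λ N ()) g=O

O-⊗ˡ : ∀ {a f} g → f =O[q^ a ] → f ⊗ g =O[q^ a ]
O-⊗ˡ {f = f} g f=O = ≗[<]-trans (≗⇒≗[<] _ (⊗-comm f g)) (O-⊗ʳ g f=O)

mono-≡ : ∀ c m → mono c m m ≡ c
mono-≡ c m with m ℕ.≟ m
... | yes _  = refl
... | no m≢m = ⊥-elim (m≢m refl)

mono-≢ : ∀ c {m N} → m ≢ N → mono c m N ≡ 0ℤ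
mono-≢ c {m} {N} m≢N with m ℕ.≟ N
... | yes m≡N = ⊥-elim (m≢N m≡N)
... | no _    = refl

mono-O : ∀ c m → mono c m =O[q^ m ]
mono-O c m N N<m = mono-≢ c (ℕP.<⇒≢ N<m ∘ sym)

mono-O-1 : ∀ c m → mono c (suc m) =O[q^ 1 ]
mono-O-1 c m = ≗[<]-weaken (s≤s z≤n) (mono-O c (suc m))

mono-+ : ∀ c a m N → mono c (a ℕ.+ m) (a ℕ.+ N) ≡ mono c m N
mono-+ c a m N with m ℕ.≟ N
... | yes refl = mono-≡ c (a ℕ.+ m)
... | no m≢N   = mono-≢ c (m≢N ∘ ℕP.+-cancelˡ-≡ a m N)

*-mono : ∀ c d m N → c * mono d m N ≡ mono (c * d) m N
*-mono c d m N with m ℕ.≟ N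
... | yes _ = refl
... | no _  = ℤP.*-zeroʳ c

⊖-mono : ∀ c m → ⊖ mono c m ≗ mono (- c) m
⊖-mono c m N with m ℕ.≟ N
... | yes _ = refl
... | no _  = refl

mono-⊗-at : ∀ c m f N → (mono c m ⊗ f) (m ℕ.+ N) ≡ c * f N
mono-⊗-at c m f N = trans
  (Σ<-single (suc (m ℕ.+ N)) _ (s≤s (ℕP.m≤m+n m N)) (λ k k≢m → cong (_* f (m ℕ.+ N ∸ k)) (mono-≢ c (k≢m ∘ sym))))
  (cong₂ _*_ (mono-≡ c m) (cong f (ℕP.m+n∸m≡n m N)))

mono-⊗-mono : ∀ c d a b → mono c a ⊗ mono d b ≗ mono (c * d) (a ℕ.+ b)
mono-⊗-mono c d a b N with N ℕ.<? a
... | yes N<a = trans (O-⊗ˡ (mono d b) (mono-O c a) N N<a)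
                      (sym (mono-O (c * d) (a ℕ.+ b) N (ℕP.<-≤-trans N<a (ℕP.m≤m+n a b))))
... | no N≮a with ℕP.m≤n⇒∃[o]m+o≡n (ℕP.≮⇒≥ N≮a)
...   | N′ , refl = begin
  (mono c a ⊗ mono d b) (a ℕ.+ N′)  ≡⟨ mono-⊗-at c a (mono d b) N′ ⟩
  c * mono d b N′                   ≡⟨ *-mono c d b N′ ⟩
  mono (c * d) b N′                 ≡⟨ mono-+ (c * d) a b N′ ⟨
  mono (c * d) (a ℕ.+ b) (a ℕ.+ N′) ∎
  where open ≡-Reasoning

q^-+ : ∀ a b → q^ a ⊗ q^ b ≗ q^ (a ℕ.+ b)
q^-+ = mono-⊗-mono 1ℤ 1ℤ

q^-split : ∀ {e} a b → e ≡ a ℕ.+ b → q^ e ≗ q^ a ⊗ q^ b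
q^-split a b e≡a+b = ≗-trans (cong-app (cong q^ e≡a+b)) (≗-sym (q^-+ a b))

mono-0 : ∀ c → mono c 0 ≗ constant c
mono-0 c zero    = mono-≡ c 0
mono-0 c (suc N) = mono-≢ c {0} {suc N} (λ ())

q^-0 : q^ 0 ≗ 𝟏
q^-0 = mono-0 1ℤ

mono≗constant⊗q^ : ∀ c m → mono c m ≗ constant c ⊗ q^ m
mono≗constant⊗q^ c m = begin
  mono c m              ≈⟨ (λ N → cong (λ d → mono d m N) (ℤP.*-identityʳ c)) ⟨
  mono (c * 1ℤ) m       ≈⟨ mono-⊗-mono c 1ℤ 0 m ⟨
  mono c 0 ⊗ q^ m       ≈⟨ ⊗-congˡ (q^ m) (mono-0 c) ⟩
  constant c ⊗ q^ m     ∎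
  where open ≗-Reasoning

invAux-fuel : ∀ {k k′} f M → M < k → M < k′ → invAux k f M ≡ invAux k′ f M
invAux-fuel {suc k} {suc k′} f zero    _         _          = refl
invAux-fuel {suc k} {suc k′} f (suc M) (s≤s M<k) (s≤s M<k′) =
  cong -_ (Σ<-cong (suc M) (λ i _ → cong (f (suc i) *_)
    (invAux-fuel f (M ∸ i) (ℕP.≤-<-trans (ℕP.m∸n≤m M i) M<k) (ℕP.≤-<-trans (ℕP.m∸n≤m M i) M<k′))))

⊗-inverseʳ : ∀ f → f 0 ≡ 1ℤ → f ⊗ inv f ≗ 𝟙
⊗-inverseʳ f f₀≡1 zero    = trans (⊗-at-0 f (inv f)) (cong (_* 1ℤ) f₀≡1)
⊗-inverseʳ f f₀≡1 (suc N) = begin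
  (f ⊗ inv f) (suc N)      ≡⟨ ⊗-at-suc f (inv f) N ⟩
  f 0 * inv f (suc N) + S  ≡⟨ cong (λ c → c * inv f (suc N) + S) f₀≡1 ⟩
  1ℤ * inv f (suc N) + S   ≡⟨ cong (_+ S) (trans (ℤP.*-identityˡ _) inv-at-suc) ⟩
  - S + S                  ≡⟨ ℤP.+-inverseˡ S ⟩
  0ℤ                       ∎
  where
  open ≡-Reasoning
  S = (shift f ⊗ inv f) N
  inv-at-suc : inv f (suc N) ≡ - S
  inv-at-suc = cong -_ (Σ<-cong (suc N) (λ i _ → cong (f (suc i) *_)
    (invAux-fuel f (N ∸ i) (s≤s (ℕP.m∸n≤m N i)) ℕP.≤-refl)))

inverse-unique : ∀ f g → f 0 ≡ 1ℤ → f ⊗ g ≗ 𝟙 → g ≗ inv f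
inverse-unique f g f₀≡1 f⊗g≗1 = begin
  g                ≈⟨ ⊗-identityʳ g ⟨
  g ⊗ 𝟙            ≈⟨ ⊗-congʳ g (⊗-inverseʳ f f₀≡1) ⟨
  g ⊗ (f ⊗ inv f)  ≈⟨ ⊗-assoc g f (inv f) ⟨
  (g ⊗ f) ⊗ inv f  ≈⟨ ⊗-congˡ (inv f) (≗-trans (⊗-comm g f) f⊗g≗1) ⟩
  𝟙 ⊗ inv f        ≈⟨ ⊗-identityˡ (inv f) ⟩
  inv f            ∎
  where open ≗-Reasoning

inv-⊗ : ∀ f g → f 0 ≡ 1ℤ → g 0 ≡ 1ℤ → inv f ≗ g ⊗ inv (f ⊗ g)
inv-⊗ f g f₀≡1 g₀≡1 = ≗-sym (inverse-unique f (g ⊗ inv (f ⊗ g)) f₀≡1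
  (≗-trans (≗-sym (⊗-assoc f g (inv (f ⊗ g)))) (⊗-inverseʳ (f ⊗ g) fg₀≡1)))
  where
  fg₀≡1 : (f ⊗ g) 0 ≡ 1ℤ
  fg₀≡1 = trans (⊗-at-0 f g) (cong₂ _*_ f₀≡1 g₀≡1)

-- Infinite sums and products

Summable : (ℕ → FPS) → Set
Summable a = ∀ n → a n =O[q^ n ]

Σ∞-truncate : ∀ a → Summable a → ∀ {N M} → N < M → Σ∞ a N ≡ Σ< M (λ n → a n N)
Σ∞-truncate a a-sum {N} N<M = sym (Σ<-extend (λ n → a n N) N<M (λ n N<n → a-sum n N N<n))

Σ∞-cong : ∀ {a b} → (∀ n → a n ≗ b n) → Σ∞ a ≗ Σ∞ b
Σ∞-cong a≗b N = Σ<-cong (suc N) (λ n _ → a≗b n N)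

Σ∞-⊕ : ∀ a b → Σ∞ (λ n → a n ⊕ b n) ≗ Σ∞ a ⊕ Σ∞ b
Σ∞-⊕ a b N = Σ<-+ (suc N) (λ n → a n N) (λ n → b n N)

Σ∞-neg : ∀ a → Σ∞ (λ n → ⊖ a n) ≗ ⊖ Σ∞ a
Σ∞-neg a N = Σ<-neg (suc N) (λ n → a n N)

Σ∞-⊖ : ∀ a b → Σ∞ (λ n → a n ⊖ b n) ≗ Σ∞ a ⊖ Σ∞ b
Σ∞-⊖ a b = ≗-trans (Σ∞-⊕ a (λ n → ⊖ b n)) (⊕-cong (≗-refl {Σ∞ a}) (Σ∞-neg b))

Σ∞-O : ∀ {k} a → (∀ n → a n =O[q^ k ]) → Σ∞ a =O[q^ k ]
Σ∞-O a a=O N N<k = Σ<-0 (suc N) (λ n _ → a=O n N N<k)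

⊗-Σ∞ : ∀ c a → Summable a → c ⊗ Σ∞ a ≗ Σ∞ (λ n → c ⊗ a n)
⊗-Σ∞ c a a-sum N = begin
  Σ< (suc N) (λ k → c k * Σ∞ a (N ∸ k))
    ≡⟨ Σ<-cong (suc N) (λ k _ → cong (c k *_) (Σ∞-truncate a a-sum (s≤s (ℕP.m∸n≤m N k)))) ⟩
  Σ< (suc N) (λ k → c k * Σ< (suc N) (λ n → a n (N ∸ k)))
    ≡⟨ Σ<-cong (suc N) (λ k _ → Σ<-*ˡ (suc N) (c k) (λ n → a n (N ∸ k))) ⟨
  Σ< (suc N) (λ k → Σ< (suc N) (λ n → c k * a n (N ∸ k)))
    ≡⟨ Σ<-swap (suc N) (suc N) (λ k n → c k * a n (N ∸ k)) ⟩
  Σ< (suc N) (λ n → (c ⊗ a n) N) ∎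
  where open ≡-Reasoning

Σ∞₁≗Σ∞∘suc : ∀ a → (∀ n → a (suc n) =O[q^ suc n ]) → Σ∞₁ a ≗ Σ∞ (a ∘ suc)
Σ∞₁≗Σ∞∘suc a a=O N =
  trans (sym (ℤP.+-identityʳ _)) (cong (_+_ (Σ∞₁ a N)) (sym (a=O N N ℕP.≤-refl)))

Σ∞-head : ∀ a → Summable a → Σ∞ a ≗ a 0 ⊕ Σ∞ (a ∘ suc)
Σ∞-head a a-sum N =
  trans (Σ<-head N (λ n → a n N)) (cong (_+_ (a 0 N)) (Σ∞₁≗Σ∞∘suc a (a-sum ∘ suc) N))

delay : (ℕ → FPS) → ℕ → FPS
delay t zero    = 𝟘
delay t (suc n) = t n

Σ∞-delay : ∀ {v} t → v =O[q^ 1 ] → Summable t → Σ∞ (λ n → v ⊗ delay t n) ≗ v ⊗ Σ∞ t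
Σ∞-delay {v} t v=O t-sum = begin
  Σ∞ (λ n → v ⊗ delay t n)         ≈⟨ Σ∞-head _ summable ⟩
  v ⊗ 𝟘 ⊕ Σ∞ (λ n → v ⊗ t n)       ≈⟨ ⊕-cong (≗-trans (⊗-comm v 𝟘) (⊗-zeroˡ v)) (≗-sym (⊗-Σ∞ v t t-sum)) ⟩
  𝟘 ⊕ v ⊗ Σ∞ t                     ≈⟨ (λ N → ℤP.+-identityˡ _) ⟩
  v ⊗ Σ∞ t                         ∎
  where
  open ≗-Reasoning
  summable : Summable (λ n → v ⊗ delay t n)
  summable zero    = λ N ()
  summable (suc n) = O-⊗ v=O (t-sum n)

Σ∞-telescope : ∀ g → Σ∞ (λ n → g n ⊖ delay g n) ≗ (λ N → g N N)
Σ∞-telescope g N = go N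
  where
  go : ∀ k → Σ< (suc k) (λ n → (g n ⊖ delay g n) N) ≡ g k N
  go zero    = trans (ℤP.+-identityˡ _) (ℤP.+-identityʳ (g 0 N))
  go (suc k) = trans (cong (_+ (g (suc k) N + - g k N)) (go k)) (cancel (g k N) (g (suc k) N))
    where cancel : ∀ x y → x + (y + - x) ≡ y
          cancel = solve-∀

Multipliable : (ℕ → FPS) → Set
Multipliable f = ∀ j → f j ≗[< suc j ] 𝟙

⊗-≗[<]𝟙ʳ : ∀ {k} p {g} → g ≗[< k ] 𝟙 → p ⊗ g ≗[< k ] p
⊗-≗[<]𝟙ʳ p g≗1 = ≗[<]-trans (⊗-cong-≗[<] (≗[<]-refl p) g≗1) (≗⇒≗[<] _ (⊗-identityʳ p))

𝟙⊖-≗[<]𝟙 : ∀ {k} g → g =O[q^ k ] → 𝟙 ⊖ g ≗[< k ] 𝟙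
𝟙⊖-≗[<]𝟙 g g=O N N<k = trans (cong (λ x → 𝟙 N + - x) (g=O N N<k)) (ℤP.+-identityʳ (𝟙 N))

∏<-≗[<]𝟙 : ∀ {k} f → (∀ j → f j ≗[< k ] 𝟙) → ∀ n → ∏< n f ≗[< k ] 𝟙
∏<-≗[<]𝟙 f f≗1 zero    = λ _ _ → refl
∏<-≗[<]𝟙 f f≗1 (suc n) = ≗[<]-trans (⊗-≗[<]𝟙ʳ (∏< n f) (f≗1 n)) (∏<-≗[<]𝟙 f f≗1 n)

∏<-stable : ∀ f → Multipliable f → ∀ {N M} → N < M → ∏< M f N ≡ ∏∞ f N
∏<-stable f f-mul {N} N<M = go (ℕP.≤⇒≤′ N<M)
  where
  go : ∀ {M} → suc N ≤′ M → ∏< M f N ≡ ∏∞ f N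
  go ≤′-refl                     = refl
  go {suc M} (≤′-step 1+N≤′M) =
    trans (⊗-≗[<]𝟙ʳ (∏< M f) (f-mul M) N (ℕP.m<n⇒m<1+n (ℕP.≤′⇒≤ 1+N≤′M))) (go 1+N≤′M)

∏<-cong : ∀ {f g} → (∀ j → f j ≗ g j) → ∀ n → ∏< n f ≗ ∏< n g
∏<-cong f≗g zero    = ≗-refl
∏<-cong f≗g (suc n) = ⊗-cong (∏<-cong f≗g n) (f≗g n)

∏∞-cong : ∀ {f g} → (∀ j → f j ≗ g j) → ∏∞ f ≗ ∏∞ g
∏∞-cong f≗g N = ∏<-cong f≗g (suc N) N

∏<-head : ∀ f n → ∏< (suc n) f ≗ f 0 ⊗ ∏< n (f ∘ suc)
∏<-head f zero    = ≗-trans (⊗-identityˡ (f 0)) (≗-sym (⊗-identityʳ (f 0)))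
∏<-head f (suc n) = ≗-trans (⊗-congˡ (f (suc n)) (∏<-head f n)) (⊗-assoc (f 0) (∏< n (f ∘ suc)) (f (suc n)))

∏∞-head : ∀ f → Multipliable f → ∏∞ f ≗ f 0 ⊗ ∏∞ (f ∘ suc)
∏∞-head f f-mul N = begin
  ∏∞ f N                          ≡⟨ ∏<-stable f f-mul (ℕP.m<n⇒m<1+n (ℕP.n<1+n N)) ⟨
  ∏< (suc (suc N)) f N            ≡⟨ ∏<-head f (suc N) N ⟩
  (f 0 ⊗ ∏< (suc N) (f ∘ suc)) N  ≡⟨ ⊗-cong-≗[<] (≗[<]-refl (f 0)) truncation N ℕP.≤-refl ⟩
  (f 0 ⊗ ∏∞ (f ∘ suc)) N          ∎
  where
  open ≡-Reasoning
  truncation : ∏< (suc N) (f ∘ suc) ≗[< suc N ] ∏∞ (f ∘ suc)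
  truncation K K<1+N = ∏<-stable (f ∘ suc) (λ j → ≗[<]-weaken (ℕP.n≤1+n (suc j)) (f-mul (suc j))) K<1+N

-- q-Pochhammer symbols

poch-factor-≗[<]𝟙 : ∀ {k x} j → x =O[q^ k ] → 𝟙 ⊖ x ⊗ q^ j ≗[< k ] 𝟙
poch-factor-≗[<]𝟙 j x=O = 𝟙⊖-≗[<]𝟙 _ (O-⊗ˡ (q^ j) x=O)

poch-at-0 : ∀ {x} → x =O[q^ 1 ] → ∀ n → poch x n 0 ≡ 1ℤ
poch-at-0 {x} x=O n = ∏<-≗[<]𝟙 (λ j → 𝟙 ⊖ x ⊗ q^ j) (λ j → poch-factor-≗[<]𝟙 j x=O) n 0 (s≤s z≤n)

poch∞-≗[<]𝟙 : ∀ {k x} → x =O[q^ k ] → poch∞ x ≗[< k ] 𝟙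
poch∞-≗[<]𝟙 {x = x} x=O N = ∏<-≗[<]𝟙 (λ j → 𝟙 ⊖ x ⊗ q^ j) (λ j → poch-factor-≗[<]𝟙 j x=O) (suc N) N

poch∞-cong : ∀ {x y} → x ≗ y → poch∞ x ≗ poch∞ y
poch∞-cong {x} {y} x≗y = ∏∞-cong (λ j → ⊕-cong (≗-refl {𝟙}) (⊖-cong (⊗-congˡ (q^ j) x≗y)))

poch∞-head : ∀ {x} → x =O[q^ 1 ] → poch∞ x ≗ (𝟙 ⊖ x) ⊗ poch∞ (x ⊗ q^ 1)
poch∞-head {x} x=O = ≗-trans (∏∞-head (λ j → 𝟙 ⊖ x ⊗ q^ j) multipliable) (⊗-cong first (∏∞-cong rest))
  where
  multipliable : Multipliable (λ j → 𝟙 ⊖ x ⊗ q^ j)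
  multipliable j = 𝟙⊖-≗[<]𝟙 _ (O-⊗ x=O (mono-O 1ℤ j))
  first : 𝟙 ⊖ x ⊗ q^ 0 ≗ 𝟙 ⊖ x
  first = ⊕-cong (≗-refl {𝟙}) (⊖-cong (≗-trans (⊗-congʳ x (≗-trans q^-0 constant-1)) (⊗-identityʳ x)))
  rest : ∀ j → 𝟙 ⊖ x ⊗ q^ (suc j) ≗ 𝟙 ⊖ (x ⊗ q^ 1) ⊗ q^ j
  rest j = ⊕-cong (≗-refl {𝟙}) (⊖-cong (≗-trans (⊗-congʳ x (≗-sym (q^-+ 1 j))) (≗-sym (⊗-assoc x (q^ 1) (q^ j)))))

inv-poch-suc : ∀ {x} → x =O[q^ 1 ] → ∀ n → inv (poch x n) ≗ (𝟙 ⊖ x ⊗ q^ n) ⊗ inv (poch x (suc n))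
inv-poch-suc {x} x=O n = inv-⊗ (poch x n) (𝟙 ⊖ x ⊗ q^ n) (poch-at-0 x=O n) (poch-factor-≗[<]𝟙 n x=O 0 (s≤s z≤n))

A : ℕ → FPS
A k = poch∞ (mono -1ℤ (suc k))

B : ℕ → FPS
B k = poch∞ (q^ (suc k))

poch∞-mono-rec : ∀ c k → poch∞ (mono c (suc k)) ≗ (𝟏 ⊖ mono c (suc k)) ⊗ poch∞ (mono c (suc (suc k)))
poch∞-mono-rec c k = ≗-trans (poch∞-head (mono-O-1 c k))
  (⊗-cong (⊕-cong 𝟙≗𝟏 (≗-refl {⊖ mono c (suc k)})) (poch∞-cong mono-⊗-q))
  where
  mono-⊗-q : mono c (suc k) ⊗ q^ 1 ≗ mono c (suc (suc k))
  mono-⊗-q = ≗-trans (mono-⊗-mono c 1ℤ (suc k) 1)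
    (λ N → cong₂ (λ d e → mono d e N) (ℤP.*-identityʳ c) (ℕP.+-comm (suc k) 1))

A-rec : ∀ k → A k ≗ (𝟏 ⊕ q^ (suc k)) ⊗ A (suc k)
A-rec k = ≗-trans (poch∞-mono-rec -1ℤ k) (⊗-congˡ (A (suc k)) (⊕-cong (≗-refl {𝟏}) (⊖-mono -1ℤ (suc k))))

B-rec : ∀ k → B k ≗ (𝟏 ⊖ q^ (suc k)) ⊗ B (suc k)
B-rec = poch∞-mono-rec 1ℤ

A-split : ∀ n m → A (n ℕ.+ m) ≗ (𝟏 ⊕ q^ n ⊗ q^ (suc m)) ⊗ A (n ℕ.+ suc m)
A-split n m = ≗-trans (A-rec (n ℕ.+ m))
  (⊗-cong (⊕-cong (≗-refl {𝟏}) (q^-split n (suc m) (sym (ℕP.+-suc n m)))) (cong-app (cong A (sym (ℕP.+-suc n m)))))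

A-≗[<]𝟙 : ∀ k → A k ≗[< suc k ] 𝟙
A-≗[<]𝟙 k = poch∞-≗[<]𝟙 (mono-O -1ℤ (suc k))

B-≗[<]𝟙 : ∀ k → B k ≗[< suc k ] 𝟙
B-≗[<]𝟙 k = poch∞-≗[<]𝟙 (mono-O 1ℤ (suc k))

inv-qq : ℕ → FPS
inv-qq n = inv (poch (q^ 1) n)

inv-qq-0 : inv-qq 0 ≗ 𝟏
inv-qq-0 = ≗-trans (≗-sym (inverse-unique 𝟙 𝟙 refl (⊗-identityˡ 𝟙))) 𝟙≗𝟏

inv-qq-suc : ∀ n → inv-qq n ≗ (𝟏 ⊖ q^ (suc n)) ⊗ inv-qq (suc n)
inv-qq-suc n = ≗-trans (inv-poch-suc (mono-O-1 1ℤ 0) n)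
  (⊗-congˡ (inv-qq (suc n)) (⊕-cong 𝟙≗𝟏 (⊖-cong (q^-+ 1 n))))

-- Families determined by their differences

Δ : (ℕ → FPS) → ℕ → FPS
Δ F m = F m ⊖ F (suc m)

Δ-Σ∞ : ∀ (t : ℕ → ℕ → FPS) m → Δ (λ m → Σ∞ (t m)) m ≗ Σ∞ (λ n → t m n ⊖ t (suc m) n)
Δ-Σ∞ t m = ≗-sym (Σ∞-⊖ (t m) (t (suc m)))

contraction-vanishes : ∀ (P : ℕ → FPS) → (∀ m → P m ≗ q^ (suc m) ⊗ P (suc m)) → ∀ m → P m ≗ 𝟘
contraction-vanishes P P-rec m N = P=O (suc N) m N ℕP.≤-refl
  where
  P=O : ∀ L m → P m =O[q^ L ]
  P=O zero    m = λ N ()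
  P=O (suc L) m = ≗[<]-trans (≗⇒≗[<] _ (P-rec m))
    (≗[<]-weaken (s≤s (ℕP.m≤n+m L m)) (O-⊗ (mono-O 1ℤ (suc m)) (P=O L (suc m))))

WRecursion : (ℕ → FPS) → Set
WRecursion D = ∀ m → D m ≗ q^ (suc m) ⊗ (𝟏 ⊕ D (suc m))

WRecursion-unique : ∀ {D D′} → WRecursion D → WRecursion D′ → ∀ m → D m ≗ D′ m
WRecursion-unique {D} {D′} D-rec D′-rec m N =
  ℤP.i-j≡0⇒i≡j (D m N) (D′ m N) (contraction-vanishes (λ m → D m ⊖ D′ m) difference-rec m N)
  where
  difference-rec : ∀ m → D m ⊖ D′ m ≗ q^ (suc m) ⊗ (D (suc m) ⊖ D′ (suc m))
  difference-rec m = ≗-trans (⊕-cong (D-rec m) (⊖-cong (D′-rec m)))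
    (solve 3 (λ v a b → v :* (con 1ℤ :+ a) :- v :* (con 1ℤ :+ b) := v :* (a :- b)) ≗-refl
      (q^ (suc m)) (D (suc m)) (D′ (suc m)))

Δ-unique : ∀ (F G : ℕ → FPS) → (∀ m → Δ F m ≗ Δ G m) → (∀ m → F m ≗[< suc m ] G m) → ∀ m → F m ≗ G m
Δ-unique F G ΔF≗ΔG F≗G m N = ℤP.i-j≡0⇒i≡j (F m N) (G m N) (trans (D-constant N) D-vanishes)
  where
  D : ℕ → FPS
  D m = F m ⊖ G m
  D-step : ∀ m → D m ≗ D (suc m)
  D-step m = begin
    F m ⊖ G m                    ≈⟨ solve 4 (λ a b c d → a :- c := ((a :- b) :- (c :- d)) :+ (b :- d)) ≗-refl
                                      (F m) (F (suc m)) (G m) (G (suc m)) ⟩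
    (Δ F m ⊖ Δ G m) ⊕ D (suc m)  ≈⟨ ⊕-cong (⊕-cong (ΔF≗ΔG m) (≗-refl {⊖ Δ G m})) (≗-refl {D (suc m)}) ⟩
    (Δ G m ⊖ Δ G m) ⊕ D (suc m)  ≈⟨ solve 2 (λ a b → (a :- a) :+ b := b) ≗-refl (Δ G m) (D (suc m)) ⟩
    D (suc m)                    ∎
    where open ≗-Reasoning
  D-constant : ∀ k → D m N ≡ D (m ℕ.+ k) N
  D-constant zero    = cong (λ i → D i N) (sym (ℕP.+-identityʳ m))
  D-constant (suc k) = trans (D-constant k) (trans (D-step (m ℕ.+ k) N) (cong (λ i → D i N) (sym (ℕP.+-suc m k))))
  D-vanishes : D (m ℕ.+ N) N ≡ 0ℤ
  D-vanishes = ≗[<]⇒⊖=O (≗[<]-sym (F≗G (m ℕ.+ N))) N (s≤s (ℕP.m≤n+m N m))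

-- The right-hand side

triangle : ℕ → ℕ
triangle zero    = 0
triangle (suc n) = triangle n ℕ.+ suc n

triangle-closed : ∀ n → (n ℕ.* suc n) / 2 ≡ triangle n
triangle-closed n = trans (cong (_/ 2) (sym (twice n))) (m*n/n≡m (triangle n) 2)
  where
  step : ∀ t n → t ℕ.* 2 ≡ n ℕ.* suc n → (t ℕ.+ suc n) ℕ.* 2 ≡ suc n ℕ.* suc (suc n)
  step t n eq = trans (ℕP.*-distribʳ-+ 2 t (suc n)) (trans (cong (ℕ._+ suc n ℕ.* 2) eq) (expand n))
    where expand : ∀ n → n ℕ.* suc n ℕ.+ suc n ℕ.* 2 ≡ suc n ℕ.* suc (suc n)
          expand = ℕ-Solver.solve-∀
  twice : ∀ n → triangle n ℕ.* 2 ≡ n ℕ.* suc n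
  twice zero    = refl
  twice (suc n) = step (triangle n) n (twice n)

-- Summands are indexed from 0: w m n and ρ m n are the (n+1)-st terms of W m and of - R m.
w : ℕ → ℕ → FPS
w m n = q^ (m ℕ.* suc n ℕ.+ triangle (suc n))

W : ℕ → FPS
W m = Σ∞ (w m)

w-=O-m : ∀ m n → w m n =O[q^ suc m ]
w-=O-m m n = ≗[<]-weaken suc-m≤ (mono-O 1ℤ _)
  where
  suc-m≤ : suc m ≤ m ℕ.* suc n ℕ.+ triangle (suc n)
  suc-m≤ = ℕP.≤-trans (ℕP.m≤m*n (suc m) (suc n)) (ℕP.≤-trans (ℕP.≤-reflexive (ℕP.+-comm (suc n) (m ℕ.* suc n)))
             (ℕP.+-monoʳ-≤ (m ℕ.* suc n) (ℕP.m≤n+m (suc n) (triangle n))))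

w-=O-n : ∀ m n → w m n =O[q^ suc n ]
w-=O-n m n = ≗[<]-weaken (ℕP.≤-trans (ℕP.m≤n+m (suc n) (triangle n)) (ℕP.m≤n+m _ (m ℕ.* suc n))) (mono-O 1ℤ _)

w-summable : ∀ m → Summable (w m)
w-summable m n = ≗[<]-weaken (ℕP.n≤1+n n) (w-=O-n m n)

w-suc-m : ∀ m n → w (suc m) n ≗ w m n ⊗ q^ (suc n)
w-suc-m m n = ≗-sym (≗-trans (q^-+ _ (suc n)) (cong-app (cong q^ (exponent m n (triangle (suc n))))))
  where exponent : ∀ m n t → m ℕ.* suc n ℕ.+ t ℕ.+ suc n ≡ suc m ℕ.* suc n ℕ.+ t
        exponent = ℕ-Solver.solve-∀

w-suc-n : ∀ m n → w m (suc n) ≗ q^ (suc m) ⊗ w (suc m) n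
w-suc-n m n = ≗-sym (≗-trans (q^-+ (suc m) _) (cong-app (cong q^ (exponent m n (triangle n)))))
  where exponent : ∀ m n t → suc m ℕ.+ (suc m ℕ.* suc n ℕ.+ (t ℕ.+ suc n))
                             ≡ m ℕ.* suc (suc n) ℕ.+ (t ℕ.+ suc n ℕ.+ suc (suc n))
        exponent = ℕ-Solver.solve-∀

W-recursion : WRecursion W
W-recursion m = begin
  W m                             ≈⟨ Σ∞-head (w m) (w-summable m) ⟩
  w m 0 ⊕ Σ∞ (w m ∘ suc)          ≈⟨ ⊕-cong (cong-app (cong q^ (exponent m))) (Σ∞-cong (w-suc-n m)) ⟩
  v ⊕ Σ∞ (λ n → v ⊗ w (suc m) n)  ≈⟨ ⊕-cong (≗-refl {v}) (⊗-Σ∞ v (w (suc m)) (w-summable (suc m))) ⟨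
  v ⊕ v ⊗ W (suc m)               ≈⟨ solve 2 (λ v x → v :+ v :* x := v :* (con 1ℤ :+ x)) ≗-refl v (W (suc m)) ⟩
  v ⊗ (𝟏 ⊕ W (suc m))             ∎
  where
  open ≗-Reasoning
  v = q^ (suc m)
  exponent : ∀ m → m ℕ.* 1 ℕ.+ 1 ≡ suc m
  exponent = ℕ-Solver.solve-∀

geometric-inverse : ∀ n → (𝟏 ⊖ q^ (suc n)) ⊗ inv (𝟙 ⊖ q^ (suc n)) ≗ 𝟏
geometric-inverse n = begin
  (𝟏 ⊖ y) ⊗ inv (𝟙 ⊖ y)  ≈⟨ ⊗-congˡ (inv (𝟙 ⊖ y)) (⊕-cong constant-1 (≗-refl {⊖ y})) ⟩
  (𝟙 ⊖ y) ⊗ inv (𝟙 ⊖ y)  ≈⟨ ⊗-inverseʳ (𝟙 ⊖ y) (𝟙⊖-≗[<]𝟙 y (mono-O 1ℤ (suc n)) 0 (s≤s z≤n)) ⟩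
  𝟙                      ≈⟨ 𝟙≗𝟏 ⟩
  𝟏                      ∎
  where
  open ≗-Reasoning
  y = q^ (suc n)

ρ : ℕ → ℕ → FPS
ρ m n = w m n ⊗ inv (𝟙 ⊖ q^ (suc n))

R : ℕ → FPS
R m = ⊖ Σ∞ (ρ m)

ρ-Δ : ∀ m n → ρ m n ⊖ ρ (suc m) n ≗ w m n
ρ-Δ m n = begin
  w m n ⊗ I ⊖ w (suc m) n ⊗ I  ≈⟨ ⊕-cong (≗-refl {w m n ⊗ I}) (⊖-cong (⊗-congˡ I (w-suc-m m n))) ⟩
  w m n ⊗ I ⊖ w m n ⊗ y ⊗ I    ≈⟨ solve 3 (λ a y i → a :* i :- a :* y :* i := a :* ((con 1ℤ :- y) :* i)) ≗-refl
                                    (w m n) y I ⟩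
  w m n ⊗ ((𝟏 ⊖ y) ⊗ I)        ≈⟨ ⊗-congʳ (w m n) (geometric-inverse n) ⟩
  w m n ⊗ 𝟏                    ≈⟨ solve 1 (λ a → a :* con 1ℤ := a) ≗-refl (w m n) ⟩
  w m n                        ∎
  where
  open ≗-Reasoning
  y = q^ (suc n)
  I = inv (𝟙 ⊖ y)

record IsRhsFamily (F : ℕ → FPS) : Set where
  field
    Δ≗⊖W : ∀ m → Δ F m ≗ ⊖ W m
    =O   : ∀ m → F m =O[q^ suc m ]

R-isRhsFamily : IsRhsFamily R
R-isRhsFamily = record { Δ≗⊖W = ΔR ; =O = R=O }
  where
  ΔR : ∀ m → Δ R m ≗ ⊖ W m
  ΔR m = begin
    ⊖ Σ∞ (ρ m) ⊖ ⊖ Σ∞ (ρ (suc m))  ≈⟨ solve 2 (λ a b → :- a :- :- b := :- (a :- b)) ≗-refl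
                                        (Σ∞ (ρ m)) (Σ∞ (ρ (suc m))) ⟩
    ⊖ Δ (λ m → Σ∞ (ρ m)) m          ≈⟨ ⊖-cong (≗-trans (Δ-Σ∞ ρ m) (Σ∞-cong (ρ-Δ m))) ⟩
    ⊖ W m                           ∎
    where open ≗-Reasoning
  R=O : ∀ m → R m =O[q^ suc m ]
  R=O m = ⊖-cong-≗[<] (Σ∞-O (ρ m) (λ n → O-⊗ˡ (inv (𝟙 ⊖ q^ (suc n))) (w-=O-m m n)))

R-0 : R 0 ≗ rhs
R-0 = ⊖-cong (≗-sym (≗-trans (Σ∞₁≗Σ∞∘suc r r=O) (Σ∞-cong term)))
  where
  r : ℕ → FPS
  r n = q^ ((n ℕ.* suc n) / 2) ⊗ inv (𝟙 ⊖ q^ n)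
  term : ∀ n → r (suc n) ≗ ρ 0 n
  term n = ⊗-congˡ (inv (𝟙 ⊖ q^ (suc n))) (cong-app (cong q^ (triangle-closed (suc n))))
  r=O : ∀ n → r (suc n) =O[q^ suc n ]
  r=O n = ≗[<]-trans (≗⇒≗[<] _ (term n)) (O-⊗ˡ (inv (𝟙 ⊖ q^ (suc n))) (w-=O-n 0 n))

IsRhsFamily⇒≗rhs : ∀ {F} → IsRhsFamily F → F 0 ≗ rhs
IsRhsFamily⇒≗rhs {F} F-rhs = ≗-trans (Δ-unique F R ΔF≗ΔR F≗R 0) R-0
  where
  open IsRhsFamily
  ΔF≗ΔR : ∀ m → Δ F m ≗ Δ R m
  ΔF≗ΔR m = ≗-trans (Δ≗⊖W F-rhs m) (≗-sym (Δ≗⊖W R-isRhsFamily m))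
  F≗R : ∀ m → F m ≗[< suc m ] R m
  F≗R m = ≗[<]-trans (=O F-rhs m) (≗[<]-sym (=O R-isRhsFamily m))

-- The left-hand side

ℓ : ℕ → ℕ → FPS
ℓ m n = (𝟙 ⊖ A (n ℕ.+ m)) ⊗ B n

L : ℕ → FPS
L m = Σ∞ (ℓ m)

u : ℕ → ℕ → FPS
u m n = q^ n ⊗ A (n ℕ.+ m) ⊗ B n

U : ℕ → FPS
U m = Σ∞ (u m)

u-summable : ∀ m → Summable (u m)
u-summable m n = O-⊗ˡ (B n) (O-⊗ˡ (A (n ℕ.+ m)) (mono-O 1ℤ n))

ℓ-Δ : ∀ m n → ℓ m n ⊖ ℓ (suc m) n ≗ ⊖ (q^ (suc m) ⊗ u (suc m) n)
ℓ-Δ m n = begin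
  (𝟙 ⊖ A (n ℕ.+ m)) ⊗ B n ⊖ (𝟙 ⊖ α) ⊗ B n
    ≈⟨ ⊕-cong (⊗-congˡ (B n) (⊕-cong 𝟙≗𝟏 (⊖-cong (A-split n m))))
              (⊖-cong (⊗-congˡ (B n) (⊕-cong 𝟙≗𝟏 (≗-refl {⊖ α})))) ⟩
  (𝟏 ⊖ (𝟏 ⊕ q^ n ⊗ v) ⊗ α) ⊗ B n ⊖ (𝟏 ⊖ α) ⊗ B n
    ≈⟨ solve 4 (λ v x a b → (con 1ℤ :- (con 1ℤ :+ x :* v) :* a) :* b :- (con 1ℤ :- a) :* b
                            := :- (v :* (x :* a :* b)))
         ≗-refl v (q^ n) α (B n) ⟩
  ⊖ (v ⊗ u (suc m) n) ∎
  where
  open ≗-Reasoning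
  v = q^ (suc m)
  α = A (n ℕ.+ suc m)

γ : ℕ → ℕ → FPS
γ m n = A (n ℕ.+ suc m) ⊗ B n

u-telescope : ∀ m n → u m n ⊖ q^ (suc m) ⊗ u (suc m) n ≗ γ m n ⊖ delay (γ m) n
u-telescope m zero = begin
  q^ 0 ⊗ A m ⊗ B 0 ⊖ v ⊗ (q^ 0 ⊗ α ⊗ B 0)
    ≈⟨ ⊕-cong (⊗-congˡ (B 0) (⊗-cong q^-0 (A-rec m))) (⊖-cong (⊗-congʳ v (⊗-congˡ (B 0) (⊗-congˡ α q^-0)))) ⟩
  𝟏 ⊗ ((𝟏 ⊕ v) ⊗ α) ⊗ B 0 ⊖ v ⊗ (𝟏 ⊗ α ⊗ B 0)
    ≈⟨ solve 3 (λ v a b → con 1ℤ :* ((con 1ℤ :+ v) :* a) :* b :- v :* (con 1ℤ :* a :* b) := a :* b :- con 0ℤ)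
         ≗-refl v α (B 0) ⟩
  α ⊗ B 0 ⊖ constant 0ℤ
    ≈⟨ ⊕-cong (≗-refl {α ⊗ B 0}) (⊖-cong constant-0) ⟩
  γ m 0 ⊖ 𝟘 ∎
  where
  open ≗-Reasoning
  v = q^ (suc m)
  α = A (suc m)
u-telescope m (suc p) = begin
  y ⊗ A (suc p ℕ.+ m) ⊗ b ⊖ v ⊗ (y ⊗ α ⊗ b)
    ≈⟨ ⊕-cong (⊗-congˡ b (⊗-congʳ y (A-split (suc p) m))) (≗-refl {⊖ (v ⊗ (y ⊗ α ⊗ b))}) ⟩
  y ⊗ ((𝟏 ⊕ y ⊗ v) ⊗ α) ⊗ b ⊖ v ⊗ (y ⊗ α ⊗ b)
    ≈⟨ solve 4 (λ y v a b → y :* ((con 1ℤ :+ y :* v) :* a) :* b :- v :* (y :* a :* b)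
                            := a :* b :- ((con 1ℤ :+ y :* v) :* a) :* ((con 1ℤ :- y) :* b))
         ≗-refl y v α b ⟩
  α ⊗ b ⊖ ((𝟏 ⊕ y ⊗ v) ⊗ α) ⊗ ((𝟏 ⊖ y) ⊗ b)
    ≈⟨ ⊕-cong (≗-refl {α ⊗ b}) (⊖-cong (⊗-cong A-previous (≗-sym (B-rec p)))) ⟩
  γ m (suc p) ⊖ γ m p ∎
  where
  open ≗-Reasoning
  v = q^ (suc m)
  y = q^ (suc p)
  α = A (suc p ℕ.+ suc m)
  b = B (suc p)
  A-previous : (𝟏 ⊕ y ⊗ v) ⊗ α ≗ A (p ℕ.+ suc m)
  A-previous = ≗-trans (≗-sym (A-split (suc p) m)) (cong-app (cong A (sym (ℕP.+-suc p m))))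

γ-diagonal : ∀ m → (λ N → γ m N N) ≗ 𝟏
γ-diagonal m N = trans (product-≗[<]𝟙 N ℕP.≤-refl) (𝟙≗𝟏 N)
  where
  product-≗[<]𝟙 : γ m N ≗[< suc N ] 𝟙
  product-≗[<]𝟙 = ≗[<]-trans
    (⊗-cong-≗[<] (≗[<]-weaken (s≤s (ℕP.m≤m+n N (suc m))) (A-≗[<]𝟙 (N ℕ.+ suc m))) (B-≗[<]𝟙 N))
    (≗⇒≗[<] _ (⊗-identityˡ 𝟙))

U-rec : ∀ m → U m ≗ 𝟏 ⊕ q^ (suc m) ⊗ U (suc m)
U-rec m = begin
  U m                                                ≈⟨ solve 2 (λ a b → a := (a :- b) :+ b) ≗-refl (U m) (v ⊗ U (suc m)) ⟩
  (U m ⊖ v ⊗ U (suc m)) ⊕ v ⊗ U (suc m)              ≈⟨ ⊕-cong difference (≗-refl {v ⊗ U (suc m)}) ⟩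
  𝟏 ⊕ v ⊗ U (suc m)                                  ∎
  where
  open ≗-Reasoning
  v = q^ (suc m)
  difference : U m ⊖ v ⊗ U (suc m) ≗ 𝟏
  difference = begin
    U m ⊖ v ⊗ U (suc m)
      ≈⟨ ⊕-cong (≗-refl {U m}) (⊖-cong (⊗-Σ∞ v (u (suc m)) (u-summable (suc m)))) ⟩
    Σ∞ (u m) ⊖ Σ∞ (λ n → v ⊗ u (suc m) n)  ≈⟨ Σ∞-⊖ (u m) (λ n → v ⊗ u (suc m) n) ⟨
    Σ∞ (λ n → u m n ⊖ v ⊗ u (suc m) n)     ≈⟨ Σ∞-cong (u-telescope m) ⟩
    Σ∞ (λ n → γ m n ⊖ delay (γ m) n)       ≈⟨ Σ∞-telescope (γ m) ⟩
    (λ N → γ m N N)                        ≈⟨ γ-diagonal m ⟩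
    𝟏                                      ∎

L-isRhsFamily : IsRhsFamily L
L-isRhsFamily = record { Δ≗⊖W = ΔL ; =O = L=O }
  where
  D : ℕ → FPS
  D m = q^ (suc m) ⊗ U (suc m)
  D-recursion : WRecursion D
  D-recursion m = ⊗-congʳ (q^ (suc m)) (U-rec (suc m))
  ΔL : ∀ m → Δ L m ≗ ⊖ W m
  ΔL m = begin
    Δ L m                                      ≈⟨ Δ-Σ∞ ℓ m ⟩
    Σ∞ (λ n → ℓ m n ⊖ ℓ (suc m) n)             ≈⟨ Σ∞-cong (ℓ-Δ m) ⟩
    Σ∞ (λ n → ⊖ (q^ (suc m) ⊗ u (suc m) n))    ≈⟨ Σ∞-neg (λ n → q^ (suc m) ⊗ u (suc m) n) ⟩
    ⊖ Σ∞ (λ n → q^ (suc m) ⊗ u (suc m) n)      ≈⟨ ⊖-cong (⊗-Σ∞ (q^ (suc m)) (u (suc m)) (u-summable (suc m))) ⟨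
    ⊖ D m                                      ≈⟨ ⊖-cong (WRecursion-unique D-recursion W-recursion m) ⟩
    ⊖ W m                                      ∎
    where open ≗-Reasoning
  ℓ=O : ∀ m n → ℓ m n =O[q^ suc m ]
  ℓ=O m n = ≗[<]-weaken (s≤s (ℕP.m≤n+m m n)) (O-⊗ˡ (B n) (≗[<]⇒⊖=O (A-≗[<]𝟙 (n ℕ.+ m))))
  L=O : ∀ m → L m =O[q^ suc m ]
  L=O m = Σ∞-O (ℓ m) (ℓ=O m)

lhs≗L0 : lhs ≗ L 0
lhs≗L0 = Σ∞-cong (λ n → ⊗-congˡ (B n) (⊕-cong (≗-refl {𝟙}) (⊖-cong (A-+0 n))))
  where
  A-+0 : ∀ n → A n ≗ A (n ℕ.+ 0)
  A-+0 n = cong-app (cong A (sym (ℕP.+-identityʳ n)))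

-- The middle sum

ξ-exponent : ℕ → ℕ → ℕ
ξ-exponent m n = n ℕ.* n ℕ.+ m ℕ.* n

ξ : ℕ → ℕ → FPS
ξ m n = constant (sgnPow n) ⊗ q^ (ξ-exponent m n) ⊗ inv-qq n ⊗ A (n ℕ.+ m)

μ : ℕ → ℕ → FPS
μ m n = constant (+ n) ⊗ ξ m n

X : ℕ → FPS
X m = Σ∞ (ξ m)

M : ℕ → FPS
M m = Σ∞ (μ m)

ξ-=O : ∀ m n → ξ m n =O[q^ ξ-exponent m n ]
ξ-=O m n = O-⊗ˡ (A (n ℕ.+ m)) (O-⊗ˡ (inv-qq n) (O-⊗ʳ (constant (sgnPow n)) (mono-O 1ℤ (ξ-exponent m n))))

n≤ξ-exponent : ∀ m n → n ≤ ξ-exponent m n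
n≤ξ-exponent m zero    = z≤n
n≤ξ-exponent m (suc p) = ℕP.≤-trans (ℕP.m≤m*n (suc p) (suc p)) (ℕP.m≤m+n _ (m ℕ.* suc p))

1+m≤ξ-exponent : ∀ m p → suc m ≤ ξ-exponent m (suc p)
1+m≤ξ-exponent m p = ℕP.+-mono-≤ {1} (s≤s z≤n) (ℕP.m≤m*n m (suc p))

ξ-summable : ∀ m → Summable (ξ m)
ξ-summable m n = ≗[<]-weaken (n≤ξ-exponent m n) (ξ-=O m n)

μ-summable : ∀ m → Summable (μ m)
μ-summable m n = O-⊗ʳ (constant (+ n)) (ξ-summable m n)

ξ-0 : ∀ m → ξ m 0 ≗ A m
ξ-0 m = begin
  𝟏 ⊗ q^ (m ℕ.* 0) ⊗ inv-qq 0 ⊗ A m  ≈⟨ ⊗-congˡ (A m) (⊗-cong (⊗-congʳ 𝟏 q^-m*0) inv-qq-0) ⟩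
  𝟏 ⊗ 𝟏 ⊗ 𝟏 ⊗ A m                    ≈⟨ solve 1 (λ a → con 1ℤ :* con 1ℤ :* con 1ℤ :* a := a) ≗-refl (A m) ⟩
  A m                                ∎
  where
  open ≗-Reasoning
  q^-m*0 : q^ (m ℕ.* 0) ≗ 𝟏
  q^-m*0 = ≗-trans (cong-app (cong q^ (ℕP.*-zeroʳ m))) q^-0

-- ξ m (p+1), ξ (m+1) (p+1) and ξ (m+2) p over common factors, which turns ξ-Δ into a ring identity.
module ξ-suc (m p : ℕ) where
  s = constant (sgnPow p)
  v = q^ (suc m)
  Q = q^ (ξ-exponent (suc (suc m)) p)
  I = inv-qq (suc p)
  y = q^ (suc p)
  α = A (suc p ℕ.+ suc m)

  ξ-m : ξ m (suc p) ≗ ⊖ s ⊗ (v ⊗ Q) ⊗ I ⊗ ((𝟏 ⊕ y ⊗ v) ⊗ α)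
  ξ-m = ⊗-cong (⊗-congˡ I (⊗-cong (constant-neg (sgnPow p)) (q^-split (suc m) _ (exponent m p))))
               (A-split (suc p) m)
    where exponent : ∀ m p → suc p ℕ.* suc p ℕ.+ m ℕ.* suc p
                             ≡ suc m ℕ.+ (p ℕ.* p ℕ.+ suc (suc m) ℕ.* p)
          exponent = ℕ-Solver.solve-∀

  ξ-1+m : ξ (suc m) (suc p) ≗ ⊖ s ⊗ (v ⊗ Q ⊗ y) ⊗ I ⊗ α
  ξ-1+m = ⊗-congˡ α (⊗-congˡ I (⊗-cong (constant-neg (sgnPow p)) (≗-trans
            (q^-split (suc m ℕ.+ ξ-exponent (suc (suc m)) p) (suc p) (exponent m p))
            (⊗-congˡ y (≗-sym (q^-+ (suc m) (ξ-exponent (suc (suc m)) p)))))))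
    where exponent : ∀ m p → suc p ℕ.* suc p ℕ.+ suc m ℕ.* suc p
                             ≡ suc m ℕ.+ (p ℕ.* p ℕ.+ suc (suc m) ℕ.* p) ℕ.+ suc p
          exponent = ℕ-Solver.solve-∀

  ξ-2+m : ξ (suc (suc m)) p ≗ s ⊗ Q ⊗ ((𝟏 ⊖ y) ⊗ I) ⊗ α
  ξ-2+m = ⊗-cong (⊗-congʳ (s ⊗ Q) (inv-qq-suc p)) (cong-app (cong A (ℕP.+-suc p (suc m))))

ξ-Δ : ∀ m n → ξ m n ⊖ ξ (suc m) n ≗ q^ (suc m) ⊗ ξ (suc m) n ⊖ q^ (suc m) ⊗ delay (ξ (suc (suc m))) n
ξ-Δ m zero = begin
  ξ m 0 ⊖ ξ (suc m) 0
    ≈⟨ ⊕-cong (≗-trans (ξ-0 m) (A-rec m)) (⊖-cong (ξ-0 (suc m))) ⟩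
  (𝟏 ⊕ v) ⊗ A (suc m) ⊖ A (suc m)
    ≈⟨ solve 2 (λ v a → (con 1ℤ :+ v) :* a :- a := v :* a :- v :* con 0ℤ) ≗-refl v (A (suc m)) ⟩
  v ⊗ A (suc m) ⊖ v ⊗ constant 0ℤ
    ≈⟨ ⊕-cong (⊗-congʳ v (≗-sym (ξ-0 (suc m)))) (⊖-cong (⊗-congʳ v constant-0)) ⟩
  v ⊗ ξ (suc m) 0 ⊖ v ⊗ 𝟘 ∎
  where
  open ≗-Reasoning
  v = q^ (suc m)
ξ-Δ m (suc p) = begin
  ξ m (suc p) ⊖ ξ (suc m) (suc p)
    ≈⟨ ⊕-cong ξ-m (⊖-cong ξ-1+m) ⟩
  ⊖ s ⊗ (v ⊗ Q) ⊗ I ⊗ ((𝟏 ⊕ y ⊗ v) ⊗ α) ⊖ ⊖ s ⊗ (v ⊗ Q ⊗ y) ⊗ I ⊗ α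
    ≈⟨ solve 6 (λ s v Q I y α →
         :- s :* (v :* Q) :* I :* ((con 1ℤ :+ y :* v) :* α) :- :- s :* (v :* Q :* y) :* I :* α
         := v :* (:- s :* (v :* Q :* y) :* I :* α) :- v :* (s :* Q :* ((con 1ℤ :- y) :* I) :* α))
         ≗-refl s v Q I y α ⟩
  v ⊗ (⊖ s ⊗ (v ⊗ Q ⊗ y) ⊗ I ⊗ α) ⊖ v ⊗ (s ⊗ Q ⊗ ((𝟏 ⊖ y) ⊗ I) ⊗ α)
    ≈⟨ ⊕-cong (⊗-congʳ v (≗-sym ξ-1+m)) (⊖-cong (⊗-congʳ v (≗-sym ξ-2+m))) ⟩
  v ⊗ ξ (suc m) (suc p) ⊖ v ⊗ ξ (suc (suc m)) p ∎
  where
  open ≗-Reasoning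
  open ξ-suc m p

μ-Δ : ∀ m n → μ m n ⊖ μ (suc m) n
            ≗ q^ (suc m) ⊗ μ (suc m) n ⊖ q^ (suc m) ⊗ delay (μ (suc (suc m))) n
                                       ⊖ q^ (suc m) ⊗ delay (ξ (suc (suc m))) n
μ-Δ m zero = begin
  constant 0ℤ ⊗ ξ m 0 ⊖ constant 0ℤ ⊗ ξ (suc m) 0
    ≈⟨ solve 3 (λ v a b → con 0ℤ :* a :- con 0ℤ :* b := v :* (con 0ℤ :* b) :- v :* con 0ℤ :- v :* con 0ℤ)
         ≗-refl v (ξ m 0) (ξ (suc m) 0) ⟩
  v ⊗ μ (suc m) 0 ⊖ v ⊗ constant 0ℤ ⊖ v ⊗ constant 0ℤ
    ≈⟨ ⊕-cong (⊕-cong (≗-refl {v ⊗ μ (suc m) 0}) (⊖-cong (⊗-congʳ v constant-0)))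
              (⊖-cong (⊗-congʳ v constant-0)) ⟩
  v ⊗ μ (suc m) 0 ⊖ v ⊗ 𝟘 ⊖ v ⊗ 𝟘 ∎
  where
  open ≗-Reasoning
  v = q^ (suc m)
μ-Δ m (suc p) = begin
  n ⊗ ξ m (suc p) ⊖ n ⊗ ξ (suc m) (suc p)
    ≈⟨ solve 3 (λ n a b → n :* a :- n :* b := n :* (a :- b)) ≗-refl n (ξ m (suc p)) (ξ (suc m) (suc p)) ⟩
  n ⊗ (ξ m (suc p) ⊖ ξ (suc m) (suc p))
    ≈⟨ ⊗-cong (constant-+ 1ℤ (+ p)) (ξ-Δ m (suc p)) ⟩
  (𝟏 ⊕ P) ⊗ (v ⊗ ξ (suc m) (suc p) ⊖ v ⊗ ξ (suc (suc m)) p)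
    ≈⟨ solve 4 (λ P v a b → (con 1ℤ :+ P) :* (v :* a :- v :* b)
                            := v :* ((con 1ℤ :+ P) :* a) :- v :* (P :* b) :- v :* b)
         ≗-refl P v (ξ (suc m) (suc p)) (ξ (suc (suc m)) p) ⟩
  v ⊗ ((𝟏 ⊕ P) ⊗ ξ (suc m) (suc p)) ⊖ v ⊗ μ (suc (suc m)) p ⊖ v ⊗ ξ (suc (suc m)) p
    ≈⟨ ⊕-cong (⊕-cong (⊗-congʳ v (⊗-congˡ (ξ (suc m) (suc p)) (≗-sym (constant-+ 1ℤ (+ p)))))
                      (≗-refl {⊖ (v ⊗ μ (suc (suc m)) p)}))
              (≗-refl {⊖ (v ⊗ ξ (suc (suc m)) p)}) ⟩
  v ⊗ μ (suc m) (suc p) ⊖ v ⊗ μ (suc (suc m)) p ⊖ v ⊗ ξ (suc (suc m)) p ∎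
  where
  open ≗-Reasoning
  v = q^ (suc m)
  n = constant (+ suc p)
  P = constant (+ p)

μ-0 : ∀ m → μ m 0 ≗ 𝟘
μ-0 m = ≗-trans (⊗-congˡ (ξ m 0) constant-0) (⊗-zeroˡ (ξ m 0))

ΔX : ∀ m → Δ X m ≗ q^ (suc m) ⊗ Δ X (suc m)
ΔX m = begin
  Δ X m                                                       ≈⟨ Δ-Σ∞ ξ m ⟩
  Σ∞ (λ n → ξ m n ⊖ ξ (suc m) n)                              ≈⟨ Σ∞-cong (ξ-Δ m) ⟩
  Σ∞ (λ n → v ⊗ ξ (suc m) n ⊖ v ⊗ delay (ξ (suc (suc m))) n)  ≈⟨ Σ∞-⊖ _ _ ⟩
  Σ∞ (λ n → v ⊗ ξ (suc m) n) ⊖ Σ∞ (λ n → v ⊗ delay (ξ (suc (suc m))) n)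
    ≈⟨ ⊕-cong (≗-sym (⊗-Σ∞ v (ξ (suc m)) (ξ-summable (suc m))))
              (⊖-cong (Σ∞-delay (ξ (suc (suc m))) (mono-O-1 1ℤ m) (ξ-summable (suc (suc m))))) ⟩
  v ⊗ X (suc m) ⊖ v ⊗ X (suc (suc m))
    ≈⟨ solve 3 (λ v a b → v :* a :- v :* b := v :* (a :- b)) ≗-refl v (X (suc m)) (X (suc (suc m))) ⟩
  v ⊗ Δ X (suc m)                                             ∎
  where
  open ≗-Reasoning
  v = q^ (suc m)

X-≗[<]𝟏 : ∀ m → X m ≗[< suc m ] 𝟏
X-≗[<]𝟏 m = ≗[<]-trans (≗⇒≗[<] _ head) (≗[<]-trans (⊕-cong-≗[<] (A-≗[<]𝟙 m) tail=O) 𝟙⊕𝟘≗𝟏)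
  where
  head : X m ≗ A m ⊕ Σ∞ (ξ m ∘ suc)
  head = ≗-trans (Σ∞-head (ξ m) (ξ-summable m)) (⊕-cong (ξ-0 m) (≗-refl {Σ∞ (ξ m ∘ suc)}))
  𝟙⊕𝟘≗𝟏 : 𝟙 ⊕ 𝟘 ≗[< suc m ] 𝟏
  𝟙⊕𝟘≗𝟏 N _ = trans (ℤP.+-identityʳ (𝟙 N)) (𝟙≗𝟏 N)
  tail=O : Σ∞ (ξ m ∘ suc) =O[q^ suc m ]
  tail=O = Σ∞-O (ξ m ∘ suc) (λ p → ≗[<]-weaken (1+m≤ξ-exponent m p) (ξ-=O m (suc p)))

X≗𝟏 : ∀ m → X m ≗ 𝟏
X≗𝟏 = Δ-unique X (λ _ → 𝟏) ΔX≗Δ𝟏 X-≗[<]𝟏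
  where
  ΔX≗Δ𝟏 : ∀ m → Δ X m ≗ 𝟏 ⊖ 𝟏
  ΔX≗Δ𝟏 m = ≗-trans (contraction-vanishes (Δ X) ΔX m) (λ N → sym (ℤP.+-inverseʳ (𝟏 N)))

⊖ΔM-recursion : WRecursion (λ m → ⊖ Δ M m)
⊖ΔM-recursion m = begin
  ⊖ Δ M m                           ≈⟨ ⊖-cong (Δ-Σ∞ μ m) ⟩
  ⊖ Σ∞ (λ n → μ m n ⊖ μ (suc m) n)  ≈⟨ ⊖-cong (Σ∞-cong (μ-Δ m)) ⟩
  ⊖ Σ∞ (λ n → a n ⊖ b n ⊖ c n)      ≈⟨ ⊖-cong (≗-trans (Σ∞-⊖ _ c) (⊕-cong (Σ∞-⊖ a b) (≗-refl {⊖ Σ∞ c}))) ⟩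
  ⊖ (Σ∞ a ⊖ Σ∞ b ⊖ Σ∞ c)            ≈⟨ ⊖-cong (⊕-cong (⊕-cong Σ∞a (⊖-cong Σ∞b)) (⊖-cong Σ∞c)) ⟩
  ⊖ (v ⊗ M (suc m) ⊖ v ⊗ M (suc (suc m)) ⊖ v ⊗ 𝟏)
    ≈⟨ solve 3 (λ v x y → :- (v :* x :- v :* y :- v :* con 1ℤ) := v :* (con 1ℤ :+ :- (x :- y))) ≗-refl
         v (M (suc m)) (M (suc (suc m))) ⟩
  v ⊗ (𝟏 ⊕ ⊖ Δ M (suc m))           ∎
  where
  open ≗-Reasoning
  v = q^ (suc m)
  a b c : ℕ → FPS
  a n = v ⊗ μ (suc m) n
  b n = v ⊗ delay (μ (suc (suc m))) n
  c n = v ⊗ delay (ξ (suc (suc m))) n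
  Σ∞a : Σ∞ a ≗ v ⊗ M (suc m)
  Σ∞a = ≗-sym (⊗-Σ∞ v (μ (suc m)) (μ-summable (suc m)))
  Σ∞b : Σ∞ b ≗ v ⊗ M (suc (suc m))
  Σ∞b = Σ∞-delay (μ (suc (suc m))) (mono-O-1 1ℤ m) (μ-summable (suc (suc m)))
  Σ∞c : Σ∞ c ≗ v ⊗ 𝟏
  Σ∞c = ≗-trans (Σ∞-delay (ξ (suc (suc m))) (mono-O-1 1ℤ m) (ξ-summable (suc (suc m))))
                (⊗-congʳ v (X≗𝟏 (suc (suc m))))

M-isRhsFamily : IsRhsFamily M
M-isRhsFamily = record { Δ≗⊖W = ΔM ; =O = M=O }
  where
  ΔM : ∀ m → Δ M m ≗ ⊖ W m
  ΔM m N = trans (sym (ℤP.neg-involutive (Δ M m N)))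
                 (cong -_ (WRecursion-unique ⊖ΔM-recursion W-recursion m N))
  μ=O : ∀ m n → μ m n =O[q^ suc m ]
  μ=O m zero    = ≗⇒≗[<] _ (μ-0 m)
  μ=O m (suc p) = O-⊗ʳ (constant (+ suc p)) (≗[<]-weaken (1+m≤ξ-exponent m p) (ξ-=O m (suc p)))
  M=O : ∀ m → M m =O[q^ suc m ]
  M=O m = Σ∞-O (μ m) (μ=O m)

mid≗M0 : mid ≗ M 0
mid≗M0 = begin
  Σ∞₁ ν                   ≈⟨ Σ∞₁≗Σ∞∘suc ν ν=O ⟩
  Σ∞ (ν ∘ suc)            ≈⟨ Σ∞-cong (ν≗μ0 ∘ suc) ⟩
  Σ∞ (μ 0 ∘ suc)          ≈⟨ (λ N → ℤP.+-identityˡ _) ⟨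
  𝟘 ⊕ Σ∞ (μ 0 ∘ suc)      ≈⟨ ⊕-cong (μ-0 0) (≗-refl {Σ∞ (μ 0 ∘ suc)}) ⟨
  μ 0 0 ⊕ Σ∞ (μ 0 ∘ suc)  ≈⟨ Σ∞-head (μ 0) (μ-summable 0) ⟨
  M 0                     ∎
  where
  open ≗-Reasoning
  ν : ℕ → FPS
  ν n = mono ((+ n) * sgnPow n) (n ℕ.* n) ⊗ inv-qq n ⊗ A n
  ν≗μ0 : ∀ n → ν n ≗ μ 0 n
  ν≗μ0 n = begin
    mono (+ n * s) (n ℕ.* n) ⊗ inv-qq n ⊗ A n
      ≈⟨ ⊗-cong (⊗-congˡ (inv-qq n) (≗-trans (mono≗constant⊗q^ (+ n * s) (n ℕ.* n))
                                              (⊗-cong (constant-* (+ n) s) exponent)))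
                (cong-app (cong A (sym (ℕP.+-identityʳ n)))) ⟩
    constant (+ n) ⊗ constant s ⊗ q^ (ξ-exponent 0 n) ⊗ inv-qq n ⊗ A (n ℕ.+ 0)
      ≈⟨ solve 5 (λ a b c d f → a :* b :* c :* d :* f := a :* (b :* c :* d :* f)) ≗-refl
           (constant (+ n)) (constant s) (q^ (ξ-exponent 0 n)) (inv-qq n) (A (n ℕ.+ 0)) ⟩
    μ 0 n ∎
    where
    s = sgnPow n
    exponent : q^ (n ℕ.* n) ≗ q^ (ξ-exponent 0 n)
    exponent = cong-app (cong q^ (sym (ℕP.+-identityʳ (n ℕ.* n))))
  ν=O : ∀ n → ν (suc n) =O[q^ suc n ]
  ν=O n = ≗[<]-trans (≗⇒≗[<] _ (ν≗μ0 (suc n))) (μ-summable 0 (suc n))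

corollary1p12 : (N : ℕ) → (lhs N ≡ mid N) × (mid N ≡ rhs N)
corollary1p12 N = trans (lhs≗rhs N) (sym (mid≗rhs N)) , mid≗rhs N
  where
  lhs≗rhs : lhs ≗ rhs
  lhs≗rhs = ≗-trans lhs≗L0 (IsRhsFamily⇒≗rhs L-isRhsFamily)
  mid≗rhs : mid ≗ rhs
  mid≗rhs = ≗-trans mid≗M0 (IsRhsFamily⇒≗rhs M-isRhsFamily)
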